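{- Let $G$ be a graph and let $E_+$ be a minimum-size set of non-edges of $G$ such that $G+E_+$ is paw-free. Then every false twin class of $G$ is also a false twin class of $G+E_+$.
   Context: All graphs are finite, simple and undirected. A paw is the four-vertex graph consisting of a triangle together with one additional vertex adjacent to exactly one vertex of the triangle; a graph is paw-free if it has no induced paw. $G+E_+$ is the graph on $V(G)$ with edge set $E(G)\cup E_+$. A false twin class of a graph is a set of vertices all of which have the same open neighborhood. -}

module Defs where

open import Data.Nat using (ℕ; zero; suc; _+_; _≤_; _<ᵇ_)
open import Data.Fin using (Fin; toℕ) renaming (zero to fzero; suc to fsuc)
open import Data.Bool using (Bool; true; false; T; _∧_; _∨_; not; if_then_else_)
open import Data.Product using (_×_)
open import Relation.Binary.PropositionalEquality using (_≡_; refl; cong₂)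
open import Relation.Nullary using (¬_)

record Graph (n : ℕ) : Set where
  field
    adj    : Fin n → Fin n → Bool
    sym    : ∀ i j → adj i j ≡ adj j i
    irrefl : ∀ i → adj i i ≡ false
open Graph public

sumFin : ∀ {n} → (Fin n → ℕ) → ℕ
sumFin {zero}  f = 0
sumFin {suc n} f = f fzero + sumFin (λ i → f (fsuc i))

edgeCount : ∀ {n} → Graph n → ℕ
edgeCount E = sumFin λ i → sumFin λ j →
  if (toℕ i <ᵇ toℕ j) ∧ adj E i j then 1 else 0

NonEdgesOf : ∀ {n} → Graph n → Graph n → Set
NonEdgesOf G E = ∀ i j → T (adj E i j) → adj G i j ≡ false

_⊕_ : ∀ {n} → Graph n → Graph n → Graph n
adj    (G ⊕ E) i j = adj G i j ∨ adj E i j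
sym    (G ⊕ E) i j = cong₂ _∨_ (sym G i j) (sym E i j)
irrefl (G ⊕ E) i rewrite irrefl G i | irrefl E i = refl

InducedPaw : ∀ {n} → Graph n → Fin n → Fin n → Fin n → Fin n → Set
InducedPaw G a b c d =
  ¬ a ≡ b × ¬ a ≡ c × ¬ a ≡ d × ¬ b ≡ c × ¬ b ≡ d × ¬ c ≡ d ×
  T (adj G a b) × T (adj G b c) × T (adj G a c) ×
  T (adj G d a) × ¬ T (adj G d b) × ¬ T (adj G d c)

PawFree : ∀ {n} → Graph n → Set
PawFree G = ∀ a b c d → ¬ InducedPaw G a b c d

MinPawFreeCompletion : ∀ {n} → Graph n → Graph n → Set
MinPawFreeCompletion G E =
  NonEdgesOf G E × PawFree (G ⊕ E) ×
  (∀ F → NonEdgesOf G F → PawFree (G ⊕ F) → edgeCount E ≤ edgeCount F)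

FalseTwinClass : ∀ {n} → Graph n → (Fin n → Set) → Set
FalseTwinClass G S = ∀ u v → S u → S v → ∀ w → adj G u w ≡ adj G v w

module Submission where

-- Let u, v be false twins of G and H = G + E.  First, uv is not an edge of E: otherwise
-- give the twin of larger E-degree a copy of the E-edges of the other one.  As G is invariant
-- under the map identifying the twins, this is again a paw-free completion, and it has
-- fewer edges because uv is lost.  Second, if u had an H-neighbour x missed by v, then ux is
-- in E, and every G-neighbour of u is also a neighbour of v, so paw-freeness leaves no
-- H-triangle through a G-edge at u.  Then deleting all E-edges at u creates no paw (a new
-- non-edge under a cherry would close such a triangle), again contradicting minimality.

open import Data.Bool using (Bool; true; false; T; _∧_; _∨_; not; if_then_else_)
open import Data.Bool.Properties using (∧-comm; ∧-zeroʳ; ∧-identityʳ; ∨-identityʳ; T-∧; T-∨)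
open import Data.Empty using (⊥; ⊥-elim)
open import Data.Fin using (Fin; toℕ; zero; suc; _≟_)
open import Data.Fin.Properties using (toℕ-injective)
open import Data.Nat using (ℕ; zero; suc; _+_; _*_; _≤_; _<_; _<ᵇ_; z≤n; s≤s)
open import Data.Nat.Properties
  using ( +-assoc; +-identityʳ; +-mono-≤; +-mono-<-≤; +-mono-≤-<; +-monoʳ-<; *-monoʳ-≤; *-monoʳ-<
        ; ≤-refl; ≤-total; ≤-antisym; ≮⇒≥; <-asym; <-irrefl; <⇒≱; m<m+n; <ᵇ-reflects-<
        ; +-0-commutativeMonoid; module ≤-Reasoning )
open import Algebra.Properties.CommutativeMonoid.Sum +-0-commutativeMonoid
  using (sum; sum-syntax; sum-cong-≗; ∑-distrib-+; ∑-comm)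
open import Data.Nat.Tactic.RingSolver using (solve-∀)
open import Data.Product using (_,_; proj₁; proj₂)
open import Data.Sum using (inj₁; inj₂)
open import Data.Vec.Functional using (updateAt)
open import Data.Vec.Functional.Properties using (map-updateAt; updateAt-updates; updateAt-minimal)
open import Defs hiding (sym)
open import Function using (_∘_; id; const)
open import Function.Bundles using (Equivalence)
open import Relation.Binary.PropositionalEquality
open import Relation.Nullary using (¬_; Dec; does; yes; no; ofʸ; ofⁿ; contradiction)
open import Relation.Nullary.Decidable using (dec-true; dec-false; T?)

sumFin≡sum : ∀ {n} (f : Fin n → ℕ) → sumFin f ≡ sum f
sumFin≡sum {zero}  f = refl
sumFin≡sum {suc n} f = cong (f zero +_) (sumFin≡sum (f ∘ suc))

sum-mono-≤ : ∀ {n} {f g : Fin n → ℕ} → (∀ i → f i ≤ g i) → sum f ≤ sum g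
sum-mono-≤ {zero}  f≤g = z≤n
sum-mono-≤ {suc n} f≤g = +-mono-≤ (f≤g zero) (sum-mono-≤ (f≤g ∘ suc))

sum-mono-< : ∀ {n} {f g : Fin n → ℕ} → (∀ i → f i ≤ g i) → ∀ k → f k < g k → sum f < sum g
sum-mono-< f≤g zero    fk<gk = +-mono-<-≤ fk<gk (sum-mono-≤ (f≤g ∘ suc))
sum-mono-< f≤g (suc k) fk<gk = +-mono-≤-< (f≤g zero) (sum-mono-< (f≤g ∘ suc) k fk<gk)

sum-updateAt : ∀ {n} (g : Fin n → ℕ) (s : Fin n) (f : ℕ → ℕ) →
  sum (updateAt g s f) + g s ≡ sum g + f (g s)
sum-updateAt {suc n} g zero    f = swap (f (g zero)) (sum (g ∘ suc)) (g zero)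
  where
  swap : ∀ a b c → a + b + c ≡ c + b + a
  swap = solve-∀
sum-updateAt {suc n} g (suc s) f = begin
  g zero + sum (updateAt (g ∘ suc) s f) + g (suc s)   ≡⟨ +-assoc (g zero) _ _ ⟩
  g zero + (sum (updateAt (g ∘ suc) s f) + g (suc s)) ≡⟨ cong (g zero +_) (sum-updateAt (g ∘ suc) s f) ⟩
  g zero + (sum (g ∘ suc) + f (g (suc s)))            ≡⟨ +-assoc (g zero) _ _ ⟨
  g zero + sum (g ∘ suc) + f (g (suc s))              ∎
  where open ≡-Reasoning

redirect : ∀ {n} → Fin n → Fin n → Fin n → Fin n
redirect s t = updateAt id s (const t)

sum-∘-redirect : ∀ {n} (g : Fin n → ℕ) (s t : Fin n) →
  sum (g ∘ redirect s t) + g s ≡ sum g + g t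
sum-∘-redirect g s t = trans (cong (_+ g s) (sum-cong-≗ (map-updateAt {f = g} (λ _ → refl) id s)))
  (sum-updateAt g s (const (g t)))

Adj : ∀ {n} → Graph n → Fin n → Fin n → Set
Adj A i j = T (adj A i j)

Adj-sym : ∀ {n} (A : Graph n) {i j} → Adj A i j → Adj A j i
Adj-sym A {i} {j} = subst T (Graph.sym A i j)

Adj⇒≢ : ∀ {n} (A : Graph n) {i j} → Adj A i j → ¬ i ≡ j
Adj⇒≢ A {i} ij refl = subst T (irrefl A i) ij

⊕-left : ∀ {n} (G E : Graph n) {i j} → Adj G i j → Adj (G ⊕ E) i j
⊕-left G E = Equivalence.from T-∨ ∘ inj₁

⊕-right : ∀ {n} (G E : Graph n) {i j} → Adj E i j → Adj (G ⊕ E) i j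
⊕-right G E = Equivalence.from T-∨ ∘ inj₂

⊕-cases : ∀ {n} (G E : Graph n) {i j} → Adj (G ⊕ E) i j → ¬ Adj G i j → Adj E i j
⊕-cases G E ij ¬Gij with Equivalence.to T-∨ ij
... | inj₁ Gij = contradiction Gij ¬Gij
... | inj₂ Eij = Eij

comap : ∀ {m n} → (Fin n → Fin m) → Graph m → Graph n
adj       (comap ρ A) i j = adj A (ρ i) (ρ j)
Graph.sym (comap ρ A) i j = Graph.sym A (ρ i) (ρ j)
irrefl    (comap ρ A) i   = irrefl A (ρ i)

isolate : ∀ {n} → Graph n → Fin n → Graph n
adj       (isolate E u) i j = adj E i j ∧ not (does (i ≟ u)) ∧ not (does (j ≟ u))
Graph.sym (isolate E u) i j = cong₂ _∧_ (Graph.sym E i j) (∧-comm (not (does (i ≟ u))) _)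
irrefl    (isolate E u) i rewrite irrefl E i = refl

isolate-⊆ : ∀ {n} (E : Graph n) u {i j} → Adj (isolate E u) i j → Adj E i j
isolate-⊆ E u = proj₁ ∘ Equivalence.to T-∧

isolate-at : ∀ {n} (E : Graph n) u j → adj (isolate E u) u j ≡ false
isolate-at E u j rewrite dec-true (u ≟ u) refl = ∧-zeroʳ (adj E u j)

isolate-away : ∀ {n} (E : Graph n) {u i j} → ¬ i ≡ u → ¬ j ≡ u →
  adj (isolate E u) i j ≡ adj E i j
isolate-away E {u} {i} {j} i≢u j≢u rewrite dec-false (i ≟ u) i≢u | dec-false (j ≟ u) j≢u =
  ∧-identityʳ (adj E i j)

𝟙 : Bool → ℕ
𝟙 x = if x then 1 else 0

𝟙-mono : ∀ {x y} → (T x → T y) → 𝟙 x ≤ 𝟙 y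
𝟙-mono {false}         _   = z≤n
𝟙-mono {true}  {true}  _   = ≤-refl
𝟙-mono {true}  {false} x⇒y = ⊥-elim (x⇒y _)

𝟙-pos : ∀ {x} → T x → 0 < 𝟙 x
𝟙-pos {true} _ = s≤s z≤n

degree : ∀ {n} → Graph n → Fin n → ℕ
degree {n} A i = ∑[ j < n ] 𝟙 (adj A i j)

total : ∀ {n} → Graph n → ℕ
total {n} A = ∑[ i < n ] degree A i

degree-by-column : ∀ {n} (A : Graph n) k → ∑[ i < n ] 𝟙 (adj A i k) ≡ degree A k
degree-by-column A k = sum-cong-≗ (λ i → cong 𝟙 (Graph.sym A i k))

𝟙-adj-split : ∀ {n} (A : Graph n) i j →
  𝟙 (adj A i j) ≡ 𝟙 ((toℕ i <ᵇ toℕ j) ∧ adj A i j) + 𝟙 ((toℕ j <ᵇ toℕ i) ∧ adj A j i)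
𝟙-adj-split A i j
  with toℕ i <ᵇ toℕ j | <ᵇ-reflects-< (toℕ i) (toℕ j)
     | toℕ j <ᵇ toℕ i | <ᵇ-reflects-< (toℕ j) (toℕ i)
... | true  | ofʸ i<j | true  | ofʸ j<i = contradiction j<i (<-asym i<j)
... | true  | _       | false | _       = sym (+-identityʳ _)
... | false | _       | true  | _       = cong 𝟙 (Graph.sym A i j)
... | false | ofⁿ i≮j | false | ofⁿ j≮i
  rewrite toℕ-injective (≤-antisym (≮⇒≥ j≮i) (≮⇒≥ i≮j)) = cong 𝟙 (irrefl A j)

total≡edgeCount+edgeCount : ∀ {n} (A : Graph n) → total A ≡ edgeCount A + edgeCount A
total≡edgeCount+edgeCount {n} A = begin
  ∑[ i < n ] ∑[ j < n ] 𝟙 (adj A i j)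
    ≡⟨ sum-cong-≗ (λ i → trans (sum-cong-≗ (𝟙-adj-split A i))
                               (∑-distrib-+ (forward i) (λ j → forward j i))) ⟩
  ∑[ i < n ] (∑[ j < n ] forward i j + ∑[ j < n ] forward j i)
    ≡⟨ ∑-distrib-+ (λ i → ∑[ j < n ] forward i j) (λ i → ∑[ j < n ] forward j i) ⟩
  ∑[ i < n ] ∑[ j < n ] forward i j + ∑[ i < n ] ∑[ j < n ] forward j i
    ≡⟨ cong (∑[ i < n ] ∑[ j < n ] forward i j +_) (∑-comm (λ i j → forward j i)) ⟩
  ∑[ i < n ] ∑[ j < n ] forward i j + ∑[ j < n ] ∑[ i < n ] forward j i
    ≡⟨ cong₂ _+_ edgeCount≡ edgeCount≡ ⟨
  edgeCount A + edgeCount A ∎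
  where
  open ≡-Reasoning
  forward : Fin n → Fin n → ℕ
  forward i j = 𝟙 ((toℕ i <ᵇ toℕ j) ∧ adj A i j)
  edgeCount≡ : edgeCount A ≡ ∑[ i < n ] ∑[ j < n ] forward i j
  edgeCount≡ = trans (sumFin≡sum {n} _) (sum-cong-≗ (λ i → sumFin≡sum {n} (forward i)))

-- Redirecting s to t gives s a copy of the edges at t, except that s and t become non-adjacent.
total-comap-redirect : ∀ {n} (E : Graph n) s t →
  total (comap (redirect s t) E) + 2 * (degree E s + 𝟙 (adj E s t)) ≡ total E + 2 * degree E t
total-comap-redirect {n} E s t = begin
  T′ + 2 * (d s + e s t)             ≡⟨ regroup T′ (d s) (e s t) ⟩
  (T′ + (d s + e s t)) + d s + e s t ≡⟨ cong (λ z → T′ + z + d s + e s t) column-s ⟨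
  (T′ + Z) + d s + e s t             ≡⟨ cong (λ z → z + d s + e s t) rows ⟩
  (X + Y) + d s + e s t              ≡⟨ exchange X Y (d s) (e s t) ⟩
  (X + d s) + (Y + e s t)            ≡⟨ cong₂ _+_ (sum-∘-redirect d s t) column-t ⟩
  (total E + d t) + (d t + 0)        ≡⟨ collect (total E) (d t) ⟩
  total E + 2 * d t                  ∎
  where
  open ≡-Reasoning
  ρ : Fin n → Fin n
  ρ = redirect s t
  e : Fin n → Fin n → ℕ
  e i j = 𝟙 (adj E i j)
  d : Fin n → ℕ
  d = degree E
  T′ X Y Z : ℕ
  T′ = total (comap ρ E)
  X = ∑[ i < n ] d (ρ i)
  Y = ∑[ i < n ] e (ρ i) t
  Z = ∑[ i < n ] e (ρ i) s
  column : ∀ k → ∑[ i < n ] e (ρ i) k + e s k ≡ d k + e t k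
  column k = trans (sum-∘-redirect (λ i → e i k) s t) (cong (_+ e t k) (degree-by-column E k))
  column-s : Z ≡ d s + e s t
  column-s = begin
    Z           ≡⟨ +-identityʳ Z ⟨
    Z + 0       ≡⟨ cong (λ z → Z + 𝟙 z) (irrefl E s) ⟨
    Z + e s s   ≡⟨ column s ⟩
    d s + e t s ≡⟨ cong (λ z → d s + 𝟙 z) (Graph.sym E t s) ⟩
    d s + e s t ∎
  column-t : Y + e s t ≡ d t + 0
  column-t = trans (column t) (cong (λ z → d t + 𝟙 z) (irrefl E t))
  rows : T′ + Z ≡ X + Y
  rows = begin
    T′ + Z
      ≡⟨ ∑-distrib-+ (λ i → ∑[ j < n ] e (ρ i) (ρ j)) (λ i → e (ρ i) s) ⟨
    ∑[ i < n ] (∑[ j < n ] e (ρ i) (ρ j) + e (ρ i) s)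
      ≡⟨ sum-cong-≗ (λ i → sum-∘-redirect (e (ρ i)) s t) ⟩
    ∑[ i < n ] (d (ρ i) + e (ρ i) t)
      ≡⟨ ∑-distrib-+ (λ i → d (ρ i)) (λ i → e (ρ i) t) ⟩
    X + Y ∎
  regroup : ∀ a b c → a + 2 * (b + c) ≡ (a + (b + c)) + b + c
  regroup = solve-∀
  exchange : ∀ a b c f → (a + b) + c + f ≡ (a + c) + (b + f)
  exchange = solve-∀
  collect : ∀ a b → (a + b) + (b + 0) ≡ a + 2 * b
  collect = solve-∀

total-isolate-< : ∀ {n} (E : Graph n) u x → Adj E u x → total (isolate E u) < total E
total-isolate-< E u x ux = sum-mono-< (λ i → sum-mono-≤ (edge-mono i)) u
  (sum-mono-< (edge-mono u) x
    (subst (λ z → 𝟙 z < 𝟙 (adj E u x)) (sym (isolate-at E u x)) (𝟙-pos ux)))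
  where
  edge-mono : ∀ i j → 𝟙 (adj (isolate E u) i j) ≤ 𝟙 (adj E i j)
  edge-mono i j = 𝟙-mono (isolate-⊆ E u)

record Paw {n} (H : Graph n) (a b c d : Fin n) : Set where
  field
    ab  : Adj H a b
    bc  : Adj H b c
    ac  : Adj H a c
    da  : Adj H d a
    ¬db : ¬ Adj H d b
    ¬dc : ¬ Adj H d c

-- The distinctness conditions of an induced paw follow from its adjacency pattern.
Paw⇒InducedPaw : ∀ {n} {H : Graph n} {a b c d} → Paw H a b c d → InducedPaw H a b c d
Paw⇒InducedPaw {H = H} p =
  Adj⇒≢ H ab , Adj⇒≢ H ac , Adj⇒≢ H (Adj-sym H da) , Adj⇒≢ H bc ,
  (λ { refl → ¬dc bc }) , (λ { refl → ¬db (Adj-sym H bc) }) ,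
  ab , bc , ac , da , ¬db , ¬dc
  where open Paw p

InducedPaw⇒Paw : ∀ {n} (H : Graph n) {a b c d} → InducedPaw H a b c d → Paw H a b c d
InducedPaw⇒Paw H (_ , _ , _ , _ , _ , _ , ab , bc , ac , da , ¬db , ¬dc) =
  record { ab = ab ; bc = bc ; ac = ac ; da = da ; ¬db = ¬db ; ¬dc = ¬dc }

¬Paw : ∀ {n} (H : Graph n) → PawFree H → ∀ {a b c d} → ¬ Paw H a b c d
¬Paw H pawFree {a} {b} {c} {d} p = pawFree a b c d (Paw⇒InducedPaw p)

PawFree-reflect : ∀ {m n} (H : Graph m) (K : Graph n) (ρ : Fin n → Fin m) →
  (∀ i j → adj K i j ≡ adj H (ρ i) (ρ j)) → PawFree H → PawFree K
PawFree-reflect H K ρ K≡H pawFree a b c d induced = ¬Paw H pawFree (record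
  { ab = to a b ab ; bc = to b c bc ; ac = to a c ac ; da = to d a da
  ; ¬db = ¬db ∘ from d b ; ¬dc = ¬dc ∘ from d c })
  where
  open Paw (InducedPaw⇒Paw K induced)
  to : ∀ i j → Adj K i j → Adj H (ρ i) (ρ j)
  to i j = subst T (K≡H i j)
  from : ∀ i j → Adj H (ρ i) (ρ j) → Adj K i j
  from i j = subst T (sym (K≡H i j))

triangle-forces-paw : ∀ {n} (H : Graph n) → PawFree H → ∀ {u v x a z} →
  Adj H u x → ¬ Adj H v x → ¬ Adj H v u → Adj H v a →
  Adj H u a → Adj H u z → Adj H a z → ⊥
triangle-forces-paw H pawFree {v = v} {x} {a} {z} ux ¬vx ¬vu va ua uz az with T? (adj H v z)
... | no ¬vz = ¬Paw H pawFree
  (record { ab = Adj-sym H ua ; bc = uz ; ac = az ; da = va ; ¬db = ¬vu ; ¬dc = ¬vz })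
... | yes vz = ¬Paw H pawFree
  (record { ab = ua ; bc = az ; ac = uz ; da = Adj-sym H ux ; ¬db = ¬xa ; ¬dc = ¬xz })
  where
  ¬xa : ¬ Adj H x a
  ¬xa xa = ¬Paw H pawFree
    (record { ab = Adj-sym H ua ; bc = ux ; ac = Adj-sym H xa ; da = va ; ¬db = ¬vu ; ¬dc = ¬vx })
  ¬xz : ¬ Adj H x z
  ¬xz xz = ¬Paw H pawFree
    (record { ab = Adj-sym H uz ; bc = ux ; ac = Adj-sym H xz ; da = vz ; ¬db = ¬vu ; ¬dc = ¬vx })

isolate-pawFree : ∀ {n} (G E : Graph n) u → PawFree (G ⊕ E) →
  (∀ {a z} → Adj G u a → Adj (G ⊕ E) u z → Adj (G ⊕ E) a z → ⊥) →
  PawFree (G ⊕ isolate E u)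
isolate-pawFree {n} G E u pawFree no-triangle a b c d induced = ¬Paw H pawFree (record
  { ab = K⊆H ab ; bc = K⊆H bc ; ac = K⊆H ac ; da = K⊆H da
  ; ¬db = reflect-nonedge da (Adj-sym K ab) ¬db
  ; ¬dc = reflect-nonedge da (Adj-sym K ac) ¬dc })
  where
  H K : Graph n
  H = G ⊕ E
  K = G ⊕ isolate E u
  open Paw (InducedPaw⇒Paw K induced)
  K⊆H : ∀ {i j} → Adj K i j → Adj H i j
  K⊆H Kij with Equivalence.to T-∨ Kij
  ... | inj₁ Gij = ⊕-left G E Gij
  ... | inj₂ Iij = ⊕-right G E (isolate-⊆ E u Iij)
  K-at-u : ∀ {j} → Adj K u j → Adj G u j
  K-at-u {j} = subst T (trans (cong (adj G u j ∨_) (isolate-at E u j)) (∨-identityʳ _))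
  -- Only pairs through u lose edges, and such a pair under a cherry of K closes a triangle at u.
  reflect-nonedge : ∀ {y z w} → Adj K y w → Adj K z w → ¬ Adj K y z → ¬ Adj H y z
  reflect-nonedge {y} {z} {w} yw zw ¬yz Hyz = by-cases (y ≟ u) (z ≟ u)
    where
    by-cases : Dec (y ≡ u) → Dec (z ≡ u) → ⊥
    by-cases (yes y≡u) _ = no-triangle (K-at-u (subst (λ k → Adj K k w) y≡u yw))
      (subst (λ k → Adj H k z) y≡u Hyz) (Adj-sym H (K⊆H zw))
    by-cases (no _) (yes z≡u) = no-triangle (K-at-u (subst (λ k → Adj K k w) z≡u zw))
      (subst (λ k → Adj H k y) z≡u (Adj-sym H Hyz)) (Adj-sym H (K⊆H yw))
    by-cases (no y≢u) (no z≢u) =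
      ¬yz (subst T (sym (cong (adj G y z ∨_) (isolate-away E y≢u z≢u))) Hyz)

FalseTwins : ∀ {n} → Graph n → Fin n → Fin n → Set
FalseTwins G u v = ∀ w → adj G u w ≡ adj G v w

FalseTwins-sym : ∀ {n} (G : Graph n) {u v} → FalseTwins G u v → FalseTwins G v u
FalseTwins-sym G twins w = sym (twins w)

FalseTwins-nonadjacent : ∀ {n} (G : Graph n) {u v} → FalseTwins G u v → adj G u v ≡ false
FalseTwins-nonadjacent G {v = v} twins = trans (twins v) (irrefl G v)

redirect-invariant : ∀ {n} (G : Graph n) {s t} → FalseTwins G s t →
  ∀ i j → adj G (redirect s t i) (redirect s t j) ≡ adj G i j
redirect-invariant {n} G {s} {t} twins i j = begin
  adj G (ρ i) (ρ j) ≡⟨ row i (ρ j) ⟩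
  adj G i (ρ j)     ≡⟨ Graph.sym G i (ρ j) ⟩
  adj G (ρ j) i     ≡⟨ row j i ⟩
  adj G j i         ≡⟨ Graph.sym G j i ⟩
  adj G i j         ∎
  where
  open ≡-Reasoning
  ρ : Fin n → Fin n
  ρ = redirect s t
  row : ∀ k w → adj G (ρ k) w ≡ adj G k w
  row k w with k ≟ s
  ... | yes refl = trans (cong (λ l → adj G l w) (updateAt-updates s id)) (sym (twins w))
  ... | no k≢s   = cong (λ l → adj G l w) (updateAt-minimal k s id k≢s)

module _ {n} (G E : Graph n) (completion : MinPawFreeCompletion G E) where

  private
    H : Graph n
    H = G ⊕ E
    nonEdges : NonEdgesOf G E
    nonEdges = proj₁ completion
    pawFree : PawFree H
    pawFree = proj₁ (proj₂ completion)

  total-minimal : ∀ F → NonEdgesOf G F → PawFree (G ⊕ F) → total E ≤ total F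
  total-minimal F nonEdgesF pawFreeF
    rewrite total≡edgeCount+edgeCount E | total≡edgeCount+edgeCount F = +-mono-≤ minimum minimum
    where
    minimum : edgeCount E ≤ edgeCount F
    minimum = proj₂ (proj₂ completion) F nonEdgesF pawFreeF

  twins-unjoined-by-degree : ∀ {s t} → FalseTwins G s t →
    degree E t ≤ degree E s → ¬ Adj E s t
  twins-unjoined-by-degree {s} {t} twins dt≤ds st = <-irrefl refl (begin-strict
    total F + 2 * degree E s
      <⟨ +-monoʳ-< (total F) (*-monoʳ-< 2 (m<m+n (degree E s) (𝟙-pos st))) ⟩
    total F + 2 * (degree E s + 𝟙 (adj E s t))
      ≡⟨ total-comap-redirect E s t ⟩
    total E + 2 * degree E t
      ≤⟨ +-mono-≤ (total-minimal F nonEdgesF pawFreeF) (*-monoʳ-≤ 2 dt≤ds) ⟩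
    total F + 2 * degree E s ∎)
    where
    open ≤-Reasoning
    ρ : Fin n → Fin n
    ρ = redirect s t
    F : Graph n
    F = comap ρ E
    nonEdgesF : NonEdgesOf G F
    nonEdgesF i j = trans (sym (redirect-invariant G twins i j)) ∘ nonEdges (ρ i) (ρ j)
    pawFreeF : PawFree (G ⊕ F)
    pawFreeF = PawFree-reflect H (G ⊕ F) ρ
      (λ i j → cong (_∨ adj F i j) (sym (redirect-invariant G twins i j))) pawFree

  twins-unjoined : ∀ {u v} → FalseTwins G u v → ¬ Adj E u v
  twins-unjoined {u} {v} twins with ≤-total (degree E v) (degree E u)
  ... | inj₁ dv≤du = twins-unjoined-by-degree twins dv≤du
  ... | inj₂ du≤dv = twins-unjoined-by-degree (FalseTwins-sym G twins) du≤dv ∘ Adj-sym E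

  no-private-neighbour : ∀ {u v x} → FalseTwins G u v →
    ¬ Adj H u v → Adj H u x → ¬ Adj H v x → ⊥
  no-private-neighbour {u} {v} {x} twins ¬uv ux ¬vx =
    <⇒≱ (total-isolate-< E u x Eux) (total-minimal (isolate E u) nonEdgesI pawFreeI)
    where
    Eux : Adj E u x
    Eux = ⊕-cases G E ux (λ Gux → ¬vx (⊕-left G E (subst T (twins x) Gux)))
    nonEdgesI : NonEdgesOf G (isolate E u)
    nonEdgesI i j = nonEdges i j ∘ isolate-⊆ E u
    pawFreeI : PawFree (G ⊕ isolate E u)
    pawFreeI = isolate-pawFree G E u pawFree λ ua uz az →
      triangle-forces-paw H pawFree ux ¬vx (¬uv ∘ Adj-sym H) (⊕-left G E (subst T (twins _) ua))
        (⊕-left G E ua) uz az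

  twins-neighbour : ∀ {u v x} → FalseTwins G u v → Adj H u x → Adj H v x
  twins-neighbour {u} {v} {x} twins ux with T? (adj H v x) | T? (adj H u v)
  ... | yes vx | _      = vx
  ... | no ¬vx | no ¬uv = ⊥-elim (no-private-neighbour twins ¬uv ux ¬vx)
  ... | no _   | yes uv =
    ⊥-elim (twins-unjoined twins (⊕-cases G E uv (subst T (FalseTwins-nonadjacent G twins))))

T-injective : ∀ {x y} → (T x → T y) → (T y → T x) → x ≡ y
T-injective {false} {false} _   _   = refl
T-injective {false} {true}  _   y⇒x = ⊥-elim (y⇒x _)
T-injective {true}  {false} x⇒y _   = ⊥-elim (x⇒y _)
T-injective {true}  {true}  _   _   = refl

lemma9 : ∀ {n} (G E : Graph n) → MinPawFreeCompletion G E →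
    ∀ (S : Fin n → Set) → FalseTwinClass G S → FalseTwinClass (G ⊕ E) S
lemma9 G E completion S twinClass u v Su Sv w =
  T-injective (twins-neighbour G E completion twins)
              (twins-neighbour G E completion (FalseTwins-sym G twins))
  where
  twins : FalseTwins G u v
  twins = twinClass u v Su Sv
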